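{- Each of the following Boolean functions $f\colon\mathbb{F}_2^k\to\mathbb{F}_2$ is a $(k,n)$-lifting for every $n\geq k$: \begin{itemize} \item $k=4$: $f=x_2 + x_3 + x_1 x_3 + x_3 x_4 + x_1 x_3 x_4$; \item $k=5$: $f=x_3 + x_2 x_5 + x_1 x_2 x_5 + x_2 x_4 x_5 + x_1 x_2 x_4 x_5$; \item $k=6$: $f=x_4 + (x_1+1)(x_2+1)x_3x_5(x_6+1)$; \item $k=7$: $f=x_5 + (x_1+1)(x_2+1)(x_3+1)x_4(x_6+1)x_7$; \item more generally, for every even $k\geq 6$: $f=x_{k-2}+\Big(\prod_{i=1}^{k-4}(x_i+1)\Big)\,x_{k-3}\,x_{k-1}\,(x_k+1)$, and for every odd $k\geq 5$: $f=x_{k-2}+\Big(\prod_{i=1}^{k-4}(x_i+1)\Big)\,x_{k-3}\,(x_{k-1}+1)\,x_k$. \end{itemize}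
   Context: For a Boolean function $f\colon\mathbb{F}_2^k\to\mathbb{F}_2$ and $n\geq k$, the map induced by $f$ on $\mathbb{F}_2^n$ is $F$ with $F(x)_i=f(x_i,\dotsc,x_{i+k-1})$ for $1\le i\le n$, indices modulo $n$ in $\{1,\dots,n\}$; $f$ is a $(k,n)$-lifting if $F$ is a bijection of $\mathbb{F}_2^n$. (In the paper these functions are written in landscape notation $1\star01$, $10\star10$, $110\star01$, $1110\star10$, $1^{k-4}0\star01$ ($k$ even), $1^{k-4}0\star10$ ($k$ odd), where $\epsilon_1\ldots\epsilon_{s-1}\star\epsilon_{s+1}\ldots\epsilon_k$ denotes $x_s+\prod_{i\neq s}(x_i+\epsilon_i)$; the explicit polynomials above are the expansions.) -}

module Defs where

open import Data.Bool using (Bool; true; false; not; _∧_; _xor_)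
open import Data.Nat using (ℕ; zero; suc; _+_; _∸_; _%_; _<_)
open import Data.Nat.DivMod using (m%n<n)
open import Data.Fin using (Fin; toℕ; fromℕ<)
open import Data.Vec using (Vec; []; _∷_; lookup; tabulate; splitAt)
open import Data.Product using (Σ; _×_; _,_)
open import Relation.Binary.PropositionalEquality using (_≡_)
open import Function.Definitions using (Bijective)

-- 𝔽₂ is modelled by Bool: addition is _xor_, multiplication is _∧_, 1 is true.
-- Variable x_i (1-indexed in the paper) is  lookup x (i-1)  (0-indexed here).

BoolFun : ℕ → Set
BoolFun k = Vec Bool k → Bool

cyc : (n : ℕ) → Fin (suc n) → ℕ → Fin (suc n)
cyc n i j = fromℕ< (m%n<n (toℕ i + j) (suc n))

induced : ∀ {k} (m : ℕ) → BoolFun k → Vec Bool (suc m) → Vec Bool (suc m)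
induced m f x = tabulate λ i → f (tabulate λ (j : Fin _) → lookup x (cyc m i (toℕ j)))

-- f is a (k,n)-lifting iff the induced map on 𝔽₂^n is a bijection.
-- (only meaningful for n ≥ k ≥ 1; the statement only uses it there)
IsLifting : ∀ {k} (n : ℕ) → BoolFun k → Set
IsLifting zero f = Bijective {A = Vec Bool 0} {B = Vec Bool 0} _≡_ _≡_ (λ x → x)
IsLifting (suc m) f = Bijective _≡_ _≡_ (induced m f)

_+1 : Bool → Bool
b +1 = not b

infixl 7 _·_
_·_ : Bool → Bool → Bool
_·_ = _∧_

infixl 6 _⊕_
_⊕_ : Bool → Bool → Bool
_⊕_ = _xor_

prodPlus1 : ∀ {m} → Vec Bool m → Bool
prodPlus1 [] = true
prodPlus1 (b ∷ v) = (b +1) · prodPlus1 v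

f4 : BoolFun 4
f4 (x1 ∷ x2 ∷ x3 ∷ x4 ∷ []) = x2 ⊕ x3 ⊕ x1 · x3 ⊕ x3 · x4 ⊕ x1 · x3 · x4

f5 : BoolFun 5
f5 (x1 ∷ x2 ∷ x3 ∷ x4 ∷ x5 ∷ []) =
  x3 ⊕ x2 · x5 ⊕ x1 · x2 · x5 ⊕ x2 · x4 · x5 ⊕ x1 · x2 · x4 · x5

f6 : BoolFun 6
f6 (x1 ∷ x2 ∷ x3 ∷ x4 ∷ x5 ∷ x6 ∷ []) = x4 ⊕ (x1 +1) · (x2 +1) · x3 · x5 · (x6 +1)

f7 : BoolFun 7
f7 (x1 ∷ x2 ∷ x3 ∷ x4 ∷ x5 ∷ x6 ∷ x7 ∷ []) =
  x5 ⊕ (x1 +1) · (x2 +1) · (x3 +1) · x4 · (x6 +1) · x7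

-- General families, with k = m + 4.  A vector of length m + 4 is split as
-- (x_1 … x_{k-4}) ++ (x_{k-3}, x_{k-2}, x_{k-1}, x_k).
-- even k ≥ 6: f = x_{k-2} + (∏_{i=1}^{k-4} (x_i+1)) x_{k-3} x_{k-1} (x_k+1)
fEven : (m : ℕ) → BoolFun (m + 4)
fEven m x with splitAt m x
... | (u , a ∷ b ∷ c ∷ d ∷ [] , _) = b ⊕ prodPlus1 u · a · c · (d +1)

fOdd : (m : ℕ) → BoolFun (m + 4)
fOdd m x with splitAt m x
... | (u , a ∷ b ∷ c ∷ d ∷ [] , _) = b ⊕ prodPlus1 u · a · (c +1) · d

{-# OPTIONS --safe #-}
-- Each f has the form x_s + P(x), where the pattern P does not read x_s, reads only
-- coordinates within distance D of s, and can never occur twice at distance at most D.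
-- Since (F x)_i = x_{i+s} + P(x_i, …), F x is x shifted by s except at the positions
-- where P occurs, and no nearby occurrence reads those; hence P occurs in F x at i
-- exactly when it occurs in x at i + s, and (F (F x))_i = x_{i+2s}. So F ∘ F is a
-- rotation and F is a bijection for every n, not only n ≥ k. The functions for
-- k = 4, 5, 6, 7 are brought into this form by checking all inputs.
module Submission where

open import Algebra.Properties.CommutativeSemigroup using (interchange)
open import Data.Bool using (Bool; true; false; not; _∧_)
open import Data.Bool.Properties using (¬-not; ⇔→≡; xor-assoc; xor-same; xor-identityʳ)
import Data.Bool.Properties as Bool
open import Data.Empty using (⊥)
open import Data.Fin using (Fin; toℕ)
open import Data.Fin.Properties using (toℕ-injective; toℕ-fromℕ<; toℕ<n)
open import Data.Nat using (ℕ; zero; suc; _+_; _*_; _∸_; _%_; _<_; _≤_; z≤n; s≤s; z<s; s<s; NonZero)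
open import Data.Nat.DivMod using (%-distribˡ-+; m%n%n≡m%n; [m+kn]%n≡m%n; m<n⇒m%n≡m)
open import Data.Nat.Properties
open import Data.Product using (_×_; _,_; proj₁; proj₂)
open import Data.Sum using (_⊎_; inj₁; inj₂)
open import Data.Vec using (Vec; []; _∷_; lookup; tabulate; take; drop; splitAt)
open import Data.Vec.Properties using (lookup∘tabulate; tabulate∘lookup; tabulate-cong)
open import Defs
open import Function using (_∘_)
open import Function.Bundles using (Bijection; mk↔ₛ′; mk⇔)
open import Function.Properties.Inverse using (Inverse⇒Bijection; ↔-refl)
open import Relation.Binary.Definitions using (tri<; tri≈; tri>)
open import Relation.Binary.PropositionalEquality
open import Relation.Nullary using (Dec)
open import Relation.Nullary.Decidable using (map′; _×-dec_; from-yes)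

[m%n+k]%n≡[m+k]%n : ∀ m k n .{{_ : NonZero n}} → (m % n + k) % n ≡ (m + k) % n
[m%n+k]%n≡[m+k]%n m k n = begin
  (m % n + k) % n           ≡⟨ %-distribˡ-+ (m % n) k n ⟩
  (m % n % n + k % n) % n   ≡⟨ cong (λ t → (t + k % n) % n) (m%n%n≡m%n m n) ⟩
  (m % n + k % n) % n       ≡⟨ %-distribˡ-+ m k n ⟨
  (m + k) % n               ∎
  where open ≡-Reasoning

toℕ-cyc : ∀ m i t → toℕ (cyc m i t) ≡ (toℕ i + t) % suc m
toℕ-cyc m i t = toℕ-fromℕ< _

cyc-+ : ∀ m i t u → cyc m (cyc m i t) u ≡ cyc m i (t + u)
cyc-+ m i t u = toℕ-injective (begin
  toℕ (cyc m (cyc m i t) u)        ≡⟨ toℕ-cyc m (cyc m i t) u ⟩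
  (toℕ (cyc m i t) + u) % suc m    ≡⟨ cong (λ r → (r + u) % suc m) (toℕ-cyc m i t) ⟩
  ((toℕ i + t) % suc m + u) % suc m ≡⟨ [m%n+k]%n≡[m+k]%n (toℕ i + t) u (suc m) ⟩
  (toℕ i + t + u) % suc m          ≡⟨ cong (_% suc m) (+-assoc (toℕ i) t u) ⟩
  (toℕ i + (t + u)) % suc m        ≡⟨ toℕ-cyc m i (t + u) ⟨
  toℕ (cyc m i (t + u))            ∎)
  where open ≡-Reasoning

cyc-multiple : ∀ m i c → cyc m i (c * suc m) ≡ i
cyc-multiple m i c = toℕ-injective (begin
  toℕ (cyc m i (c * suc m))       ≡⟨ toℕ-cyc m i (c * suc m) ⟩
  (toℕ i + c * suc m) % suc m     ≡⟨ [m+kn]%n≡m%n (toℕ i) c (suc m) ⟩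
  toℕ i % suc m                   ≡⟨ m<n⇒m%n≡m (toℕ<n i) ⟩
  toℕ i                           ∎)
  where open ≡-Reasoning

rotate : ∀ m → ℕ → Vec Bool (suc m) → Vec Bool (suc m)
rotate m t x = tabulate λ i → lookup x (cyc m i t)

rotate-multiple : ∀ m c x → rotate m (c * suc m) x ≡ x
rotate-multiple m c x = trans (tabulate-cong λ i → cong (lookup x) (cyc-multiple m i c)) (tabulate∘lookup x)

inducedRotated : ∀ {k} m → BoolFun k → ℕ → Vec Bool (suc m) → Vec Bool (suc m)
inducedRotated m f t x = tabulate λ i → f (tabulate λ (j : Fin _) → lookup x (cyc m i (toℕ j + t)))

induced≡inducedRotated0 : ∀ {k} m (f : BoolFun k) x → induced m f x ≡ inducedRotated m f 0 x
induced≡inducedRotated0 m f x = tabulate-cong λ i → cong f (tabulate-cong λ j →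
  cong (lookup x ∘ cyc m i) (sym (+-identityʳ (toℕ j))))

SquareIsShift : ∀ {k} → BoolFun k → ℕ → Set
SquareIsShift {k} f a = ∀ (Z : ℕ → Bool) →
  f (tabulate λ (j : Fin k) → f (tabulate λ (l : Fin k) → Z (toℕ j + toℕ l))) ≡ Z a

module _ {k} {f : BoolFun k} {a : ℕ} (square : SquareIsShift f a) where

  inducedRotated-∘ : ∀ m t u x → inducedRotated m f t (inducedRotated m f u x) ≡ rotate m (a + (t + u)) x
  inducedRotated-∘ m t u x = tabulate-cong λ i → begin
    f (tabulate λ l → lookup (inducedRotated m f u x) (cyc m i (toℕ l + t)))
      ≡⟨ cong f (tabulate-cong λ l → lookup∘tabulate Fᵤx (cyc m i (toℕ l + t))) ⟩
    f (tabulate λ l → f (tabulate λ j → lookup x (cyc m (cyc m i (toℕ l + t)) (toℕ j + u))))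
      ≡⟨ cong f (tabulate-cong λ l → cong f (tabulate-cong λ j → cong (lookup x)
           (trans (cyc-+ m i _ _) (cong (cyc m i) (interchange +-commutativeSemigroup (toℕ l) t (toℕ j) u))))) ⟩
    f (tabulate λ l → f (tabulate λ j → lookup x (cyc m i (toℕ l + toℕ j + (t + u)))))
      ≡⟨ square (λ r → lookup x (cyc m i (r + (t + u)))) ⟩
    lookup x (cyc m i (a + (t + u))) ∎
    where
    open ≡-Reasoning
    Fᵤx : Fin (suc m) → Bool
    Fᵤx i′ = f (tabulate λ j → lookup x (cyc m i′ (toℕ j + u)))

  -- a * m ≡ -a (mod m + 1), so rotating by a * m undoes the rotation by a that F ∘ F performs.
  squareIsShift⇒lifting : ∀ n → IsLifting n f
  squareIsShift⇒lifting zero = Bijection.bijective (Inverse⇒Bijection ↔-refl)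
  squareIsShift⇒lifting (suc m) = Bijection.bijective (Inverse⇒Bijection (mk↔ₛ′ F G F∘G G∘F))
    where
    F G : Vec Bool (suc m) → Vec Bool (suc m)
    F = induced m f
    G = inducedRotated m f (a * m)
    rotate-a+am : ∀ x → rotate m (a + a * m) x ≡ x
    rotate-a+am x = trans (cong (λ t → rotate m t x) (sym (*-suc a m))) (rotate-multiple m a x)
    F∘G : ∀ y → F (G y) ≡ y
    F∘G y = begin
      F (G y)                        ≡⟨ induced≡inducedRotated0 m f (G y) ⟩
      inducedRotated m f 0 (G y)     ≡⟨ inducedRotated-∘ m 0 (a * m) y ⟩
      rotate m (a + a * m) y         ≡⟨ rotate-a+am y ⟩
      y                              ∎
      where open ≡-Reasoning
    G∘F : ∀ x → G (F x) ≡ x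
    G∘F x = begin
      G (F x)                        ≡⟨ cong G (induced≡inducedRotated0 m f x) ⟩
      G (inducedRotated m f 0 x)     ≡⟨ inducedRotated-∘ m (a * m) 0 x ⟩
      rotate m (a + (a * m + 0)) x   ≡⟨ cong (λ t → rotate m (a + t) x) (+-identityʳ (a * m)) ⟩
      rotate m (a + a * m) x         ≡⟨ rotate-a+am x ⟩
      x                              ∎
      where open ≡-Reasoning

inducedℕ : ((ℕ → Bool) → Bool) → (ℕ → Bool) → ℕ → Bool
inducedℕ g V j = g (λ l → V (j + l))

Fires : ((ℕ → Bool) → Bool) → (ℕ → Bool) → ℕ → Set
Fires P V e = inducedℕ P V e ≡ true

rule : ℕ → ((ℕ → Bool) → Bool) → (ℕ → Bool) → Bool
rule s P A = A s ⊕ P A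

Neighbours : ℕ → ℕ → ℕ → Set
Neighbours D x y = x ≢ y × x ≤ y + D × y ≤ x + D

Local : ((ℕ → Bool) → Bool) → ℕ → ℕ → Set
Local P s D = ∀ A B → (∀ r → Neighbours D r s → A r ≡ B r) → P A ≡ P B

Exclusive : ((ℕ → Bool) → Bool) → ℕ → Set
Exclusive P D = ∀ V x y → Neighbours D x y → Fires P V x → Fires P V y → ⊥

Neighbours-+ : ∀ {D x y} c → Neighbours D x y → Neighbours D (c + x) (c + y)
Neighbours-+ {D} {x} {y} c (x≢y , x≤y+D , y≤x+D) =
  x≢y ∘ +-cancelˡ-≡ c x y , shift x≤y+D , shift y≤x+D
  where
  shift : ∀ {u v} → u ≤ v + D → c + u ≤ c + v + D
  shift {u} {v} u≤v+D = subst (c + u ≤_) (sym (+-assoc c v D)) (+-monoʳ-≤ c u≤v+D)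

left-neighbour : ∀ {D r s} → r < s → s ≤ D → Neighbours D r s
left-neighbour {D} {r} {s} r<s s≤D = <⇒≢ r<s , ≤-trans (<⇒≤ r<s) (m≤m+n s D) , ≤-trans s≤D (m≤n+m D r)

right-neighbour : ∀ {D r s} → s < r → r ≤ s + D → Neighbours D r s
right-neighbour {D} {r} {s} s<r r≤s+D = >⇒≢ s<r , r≤s+D , ≤-trans (<⇒≤ s<r) (m≤m+n r D)

ExclusiveAtShifts : ((ℕ → Bool) → Bool) → ℕ → Set
ExclusiveAtShifts P D = ∀ V e d → suc d ≤ D → Fires P V e → Fires P V (e + suc d) → ⊥

exclusiveAtShifts-< : ∀ {P D} → ExclusiveAtShifts P D →
  ∀ V {x y} → x < y → y ≤ x + D → Fires P V x → Fires P V y → ⊥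
exclusiveAtShifts-< {P} {D} shifts V {x} {y} x<y y≤x+D Px Py with m≤n⇒∃[o]m+o≡n x<y
... | d , 1+x+d≡y = shifts V x d 1+d≤D Px (subst (Fires P V) (sym x+[1+d]≡y) Py)
  where
  x+[1+d]≡y : x + suc d ≡ y
  x+[1+d]≡y = trans (+-suc x d) 1+x+d≡y
  1+d≤D : suc d ≤ D
  1+d≤D = +-cancelˡ-≤ x (suc d) D (subst (_≤ x + D) (sym x+[1+d]≡y) y≤x+D)

exclusiveAtShifts⇒exclusive : ∀ {P D} → ExclusiveAtShifts P D → Exclusive P D
exclusiveAtShifts⇒exclusive {P} shifts V x y (x≢y , x≤y+D , y≤x+D) Px Py with <-cmp x y
... | tri< x<y _ _ = exclusiveAtShifts-< {P} shifts V x<y y≤x+D Px Py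
... | tri≈ _ x≡y _ = x≢y x≡y
... | tri> _ _ y<x = exclusiveAtShifts-< {P} shifts V y<x x≤y+D Py Px

module _ {s D : ℕ} {P : (ℕ → Bool) → Bool} (local : Local P s D) (exclusive : Exclusive P D) where

  private
    F : (ℕ → Bool) → ℕ → Bool
    F = inducedℕ (rule s P)

  P-cong : ∀ A B → (∀ r → A r ≡ B r) → P A ≡ P B
  P-cong A B A≗B = local A B (λ r _ → A≗B r)

  F-quiet : ∀ V c r → inducedℕ P V (c + r) ≡ false → F V (c + r) ≡ V (c + s + r)
  F-quiet V c r quiet = begin
    V (c + r + s) ⊕ inducedℕ P V (c + r) ≡⟨ cong (V (c + r + s) ⊕_) quiet ⟩
    V (c + r + s) ⊕ false                ≡⟨ xor-identityʳ _ ⟩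
    V (c + r + s)                        ≡⟨ cong V (trans (+-assoc c r s) (trans (cong (c +_) (+-comm r s)) (sym (+-assoc c s r)))) ⟩
    V (c + s + r)                        ∎
    where open ≡-Reasoning

  firing-transport : ∀ V c → (∀ r → Neighbours D r s → inducedℕ P V (c + r) ≡ false) →
    inducedℕ P (F V) c ≡ inducedℕ P V (c + s)
  firing-transport V c quiet = local _ _ λ r near → F-quiet V c r (quiet r near)

  firing-preserved : ∀ V c → Fires P V (c + s) → Fires P (F V) c
  firing-preserved V c fires = trans (firing-transport V c quiet) fires
    where
    quiet : ∀ r → Neighbours D r s → inducedℕ P V (c + r) ≡ false
    quiet r near = ¬-not λ fires′ → exclusive V (c + r) (c + s) (Neighbours-+ c near) fires′ fires

  firing-reflected : ∀ V → Fires P (F V) s → Fires P V (s + s)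
  firing-reflected V fires = trans (sym (firing-transport V s quiet)) fires
    where
    quiet : ∀ r → Neighbours D r s → inducedℕ P V (s + r) ≡ false
    quiet r near = ¬-not λ fires′ → exclusive (F V) r s near
      (firing-preserved V r (subst (Fires P V) (+-comm s r) fires′)) fires

  firing-shift : ∀ V → inducedℕ P (F V) s ≡ inducedℕ P V (s + s)
  firing-shift V = ⇔→≡ (mk⇔ (firing-reflected V) (firing-preserved V s))

  -- firing-shift needs room for occurrences up to s positions to the left, so Z is first moved s steps right.
  firing-shift₀ : ∀ Z → P (F Z) ≡ inducedℕ P Z s
  firing-shift₀ Z = begin
    P (F Z)                    ≡⟨ P-cong _ _ (λ r → rule-cong (λ l → V-shift r l)) ⟨
    inducedℕ P (F V) s         ≡⟨ firing-shift V ⟩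
    inducedℕ P V (s + s)       ≡⟨ P-cong _ _ (V-shift s) ⟩
    inducedℕ P Z s             ∎
    where
    open ≡-Reasoning
    V : ℕ → Bool
    V t = Z (t ∸ s)
    V-shift : ∀ t r → V (s + t + r) ≡ Z (t + r)
    V-shift t r = cong Z (trans (cong (_∸ s) (+-assoc s t r)) (m+n∸m≡n s (t + r)))
    rule-cong : ∀ {A B} → (∀ r → A r ≡ B r) → rule s P A ≡ rule s P B
    rule-cong {A} {B} A≗B = cong₂ _⊕_ (A≗B s) (P-cong A B A≗B)

  rule-square : ∀ Z → rule s P (F Z) ≡ Z (s + s)
  rule-square Z = begin
    (Z (s + s) ⊕ p) ⊕ P (F Z) ≡⟨ cong ((Z (s + s) ⊕ p) ⊕_) (firing-shift₀ Z) ⟩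
    (Z (s + s) ⊕ p) ⊕ p       ≡⟨ xor-assoc (Z (s + s)) p p ⟩
    Z (s + s) ⊕ (p ⊕ p)       ≡⟨ cong (Z (s + s) ⊕_) (xor-same p) ⟩
    Z (s + s) ⊕ false         ≡⟨ xor-identityʳ _ ⟩
    Z (s + s)                 ∎
    where
    open ≡-Reasoning
    p : Bool
    p = inducedℕ P Z s

Represents : ∀ {k} → BoolFun k → ((ℕ → Bool) → Bool) → Set
Represents {k} f g = ∀ H → f (tabulate λ (i : Fin k) → H (toℕ i)) ≡ g H

represents-≗ : ∀ {k} {f f′ : BoolFun k} {g} → (∀ x → f x ≡ f′ x) → Represents f′ g → Represents f g
represents-≗ f≗f′ f′~g H = trans (f≗f′ _) (f′~g H)

represents⇒squareIsShift : ∀ {k} {f : BoolFun k} {g a} → Represents f g →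
  (∀ Z → g (inducedℕ g Z) ≡ Z a) → SquareIsShift f a
represents⇒squareIsShift {f = f} {g} f~g square Z =
  trans (cong f (tabulate-cong λ j → f~g (λ l → Z (toℕ j + l))))
        (trans (f~g (inducedℕ g Z)) (square Z))

rule-lifting : ∀ {k} {f : BoolFun k} {s D P} → Local P s D → Exclusive P D →
  Represents f (rule s P) → ∀ n → IsLifting n f
rule-lifting {f = f} local exclusive f~rule =
  squareIsShift⇒lifting (represents⇒squareIsShift {f = f} f~rule (rule-square local exclusive))

∀-Vec? : ∀ n {Q : Vec Bool n → Set} → (∀ v → Dec (Q v)) → Dec (∀ v → Q v)
∀-Vec? zero Q? = map′ (λ q → λ { [] → q }) (λ ∀q → ∀q []) (Q? [])
∀-Vec? (suc n) Q? = map′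
  (λ { (qᵗ , qᶠ) → λ { (true ∷ v) → qᵗ v ; (false ∷ v) → qᶠ v } })
  (λ ∀q → ∀q ∘ (true ∷_) , ∀q ∘ (false ∷_))
  (∀-Vec? n (Q? ∘ (true ∷_)) ×-dec ∀-Vec? n (Q? ∘ (false ∷_)))

∧≡true⇒ : ∀ {x y} → x ∧ y ≡ true → x ≡ true × y ≡ true
∧≡true⇒ {true} {true} _ = refl , refl

not≡true⇒ : ∀ {x} → not x ≡ true → x ≡ false
not≡true⇒ {false} _ = refl

clash : ∀ (V : ℕ → Bool) {x y} → x ≡ y → V x ≡ true → V y ≡ false → ⊥
clash V refl Vx Vy with () ← trans (sym Vx) Vy

take-tabulate : ∀ {A : Set} m {n} (H : ℕ → A) →
  take m (tabulate {n = m + n} (H ∘ toℕ)) ≡ tabulate (H ∘ toℕ)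
take-tabulate zero H = refl
take-tabulate (suc m) H = cong (H 0 ∷_) (take-tabulate m (H ∘ suc))

drop-tabulate : ∀ {A : Set} m {n} (H : ℕ → A) →
  drop m (tabulate {n = m + n} (H ∘ toℕ)) ≡ tabulate (λ i → H (toℕ i + m))
drop-tabulate zero H = tabulate-cong λ i → cong H (sym (+-identityʳ (toℕ i)))
drop-tabulate (suc m) H = trans (drop-tabulate m (H ∘ suc)) (tabulate-cong λ i → cong H (sym (+-suc (toℕ i) m)))

f4Pattern : (ℕ → Bool) → Bool
f4Pattern A = (A 0 +1) · A 2 · (A 3 +1)

f4Rule : BoolFun 4
f4Rule (a ∷ b ∷ c ∷ d ∷ []) = b ⊕ (a +1) · c · (d +1)

f4≗f4Rule : ∀ x → f4 x ≡ f4Rule x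
f4≗f4Rule = from-yes (∀-Vec? 4 λ x → f4 x Bool.≟ f4Rule x)

f4-represents : Represents f4 (rule 1 f4Pattern)
f4-represents = represents-≗ f4≗f4Rule λ H → refl

f4-local : Local f4Pattern 1 2
f4-local A B A≗B = cong₂ _·_
  (cong₂ _·_ (cong not (A≗B 0 (left-neighbour z<s (s≤s z≤n)))) (A≗B 2 (right-neighbour (s<s z<s) (s≤s (s≤s z≤n)))))
  (cong not (A≗B 3 (right-neighbour (s<s z<s) ≤-refl)))

f4Pattern-fires : ∀ A → f4Pattern A ≡ true → A 0 ≡ false × A 2 ≡ true × A 3 ≡ false
f4Pattern-fires A fires with ∧≡true⇒ {(A 0 +1) · A 2} fires
... | fires₀₂ , A₃≡false with ∧≡true⇒ {A 0 +1} fires₀₂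
... | A₀≡false , A₂≡true = not≡true⇒ A₀≡false , A₂≡true , not≡true⇒ A₃≡false

f4-exclusive : Exclusive f4Pattern 2
f4-exclusive = exclusiveAtShifts⇒exclusive {f4Pattern} shifts
  where
  shifts : ExclusiveAtShifts f4Pattern 2
  shifts V e 0 _ fires fires′
    with f4Pattern-fires (λ r → V (e + r)) fires | f4Pattern-fires (λ r → V (e + 1 + r)) fires′
  ... | _ , _ , V[e+3]≡false | _ , V[e+1+2]≡true , _ = clash V (+-assoc e 1 2) V[e+1+2]≡true V[e+3]≡false
  shifts V e 1 _ fires fires′
    with f4Pattern-fires (λ r → V (e + r)) fires | f4Pattern-fires (λ r → V (e + 2 + r)) fires′
  ... | _ , V[e+2]≡true , _ | V[e+2+0]≡false , _ , _ =
    clash V (sym (+-identityʳ (e + 2))) V[e+2]≡true V[e+2+0]≡false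
  shifts V e (suc (suc d)) (s≤s (s≤s ()))

zeroPrefix : ℕ → (ℕ → Bool) → Bool
zeroPrefix zero A = true
zeroPrefix (suc m) A = (A 0 +1) · zeroPrefix m (A ∘ suc)

zeroPrefix-cong : ∀ m A B → (∀ i → i < m → A i ≡ B i) → zeroPrefix m A ≡ zeroPrefix m B
zeroPrefix-cong zero A B _ = refl
zeroPrefix-cong (suc m) A B A≗B =
  cong₂ _·_ (cong not (A≗B 0 z<s)) (zeroPrefix-cong m (A ∘ suc) (B ∘ suc) (λ i i<m → A≗B (suc i) (s<s i<m)))

zeroPrefix≡true⇒ : ∀ m A → zeroPrefix m A ≡ true → ∀ i → i < m → A i ≡ false
zeroPrefix≡true⇒ (suc m) A prefix zero _ = not≡true⇒ (proj₁ (∧≡true⇒ {A 0 +1} prefix))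
zeroPrefix≡true⇒ (suc m) A prefix (suc i) (s<s i<m) =
  zeroPrefix≡true⇒ m (A ∘ suc) (proj₂ (∧≡true⇒ {A 0 +1} prefix)) i i<m

prodPlus1-tabulate : ∀ m (H : ℕ → Bool) → prodPlus1 (tabulate {n = m} (H ∘ toℕ)) ≡ zeroPrefix m H
prodPlus1-tabulate zero H = refl
prodPlus1-tabulate (suc m) H = cong (H 0 +1 ·_) (prodPlus1-tabulate m (H ∘ suc))

literal : Bool → Bool → Bool
literal true x = x
literal false x = x +1

literal≡true⇒ : ∀ γ {x} → literal γ x ≡ true → x ≡ γ
literal≡true⇒ true x≡true = x≡true
literal≡true⇒ false x+1≡true = not≡true⇒ x+1≡true

-- In the paper's landscape notation, rule (suc m) (blockPattern m γ δ) is 1^m 0 ⋆ (γ + 1) (δ + 1).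
blockPattern : ℕ → Bool → Bool → (ℕ → Bool) → Bool
blockPattern m γ δ A = zeroPrefix m A · A m · literal γ (A (2 + m)) · literal δ (A (3 + m))

record BlockOccurrence (m : ℕ) (γ δ : Bool) (A : ℕ → Bool) : Set where
  field
    zeros : ∀ i → i < m → A i ≡ false
    one : A m ≡ true
    right₁ : A (2 + m) ≡ γ
    right₂ : A (3 + m) ≡ δ

blockPattern-occurrence : ∀ m γ δ A → blockPattern m γ δ A ≡ true → BlockOccurrence m γ δ A
blockPattern-occurrence m γ δ A fires
  with ∧≡true⇒ {zeroPrefix m A · A m · literal γ (A (2 + m))} fires
... | fires₀₁₂ , right₂ with ∧≡true⇒ {zeroPrefix m A · A m} fires₀₁₂
... | fires₀₁ , right₁ with ∧≡true⇒ {zeroPrefix m A} fires₀₁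
... | prefix , one = record
  { zeros = zeroPrefix≡true⇒ m A prefix
  ; one = one
  ; right₁ = literal≡true⇒ γ right₁
  ; right₂ = literal≡true⇒ δ right₂
  }

blockRule : ∀ {m} → Bool → Bool → Vec Bool m → Vec Bool 4 → Bool
blockRule γ δ u (a ∷ b ∷ c ∷ d ∷ []) = b ⊕ prodPlus1 u · a · literal γ c · literal δ d

fEven≡blockRule : ∀ m x → fEven m x ≡ blockRule true false (take m x) (drop m x)
fEven≡blockRule m x with splitAt m x
... | u , a ∷ b ∷ c ∷ d ∷ [] , _ = refl

fOdd≡blockRule : ∀ m x → fOdd m x ≡ blockRule false true (take m x) (drop m x)
fOdd≡blockRule m x with splitAt m x
... | u , a ∷ b ∷ c ∷ d ∷ [] , _ = refl

blockRule-represents : ∀ m γ δ →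
  Represents (λ x → blockRule γ δ (take m x) (drop m x)) (rule (suc m) (blockPattern m γ δ))
blockRule-represents m γ δ H = begin
  blockRule γ δ (take m (tabulate (H ∘ toℕ))) (drop m (tabulate (H ∘ toℕ)))
    ≡⟨ cong₂ (blockRule γ δ) (take-tabulate m H) (drop-tabulate m H) ⟩
  blockRule γ δ (tabulate {n = m} (H ∘ toℕ)) (tabulate λ i → H (toℕ i + m))
    ≡⟨ cong (λ p → H (suc m) ⊕ p · H m · literal γ (H (2 + m)) · literal δ (H (3 + m))) (prodPlus1-tabulate m H) ⟩
  rule (suc m) (blockPattern m γ δ) H ∎
  where open ≡-Reasoning

block-local : ∀ {m} γ δ → 1 ≤ m → Local (blockPattern m γ δ) (suc m) (suc m)
block-local {m} γ δ 1≤m A B A≗B = cong₂ _·_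
  (cong₂ _·_
    (cong₂ _·_ (zeroPrefix-cong m A B λ i i<m → A≗B i (left-neighbour (m<n⇒m<1+n i<m) ≤-refl))
               (A≗B m (left-neighbour (n<1+n m) ≤-refl)))
    (cong (literal γ) (A≗B (2 + m) (right-neighbour (n<1+n (suc m)) (≤-trans (n≤1+n (2 + m)) 3+m≤2s)))))
  (cong (literal δ) (A≗B (3 + m) (right-neighbour (m<n⇒m<1+n (n<1+n (suc m))) 3+m≤2s)))
  where
  3+m≤2s : 3 + m ≤ suc m + suc m
  3+m≤2s = subst (_≤ suc m + suc m) (+-comm (suc m) 2) (+-monoʳ-≤ (suc m) (s≤s 1≤m))

block-exclusive : ∀ {m} γ δ →
  (∀ V e → BlockOccurrence m γ δ (λ r → V (e + r)) → BlockOccurrence m γ δ (λ r → V (e + suc m + r)) → ⊥) →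
  Exclusive (blockPattern m γ δ) (suc m)
block-exclusive {m} γ δ farthest = exclusiveAtShifts⇒exclusive {blockPattern m γ δ} shifts
  where
  occurrence : ∀ V e → Fires (blockPattern m γ δ) V e → BlockOccurrence m γ δ (λ r → V (e + r))
  occurrence V e = blockPattern-occurrence m γ δ (λ r → V (e + r))
  shifts : ExclusiveAtShifts (blockPattern m γ δ) (suc m)
  shifts V e d (s≤s d≤m) fires fires′ with m≤n⇒m<n∨m≡n d≤m
  ... | inj₂ refl = farthest V e (occurrence V e fires) (occurrence V (e + suc m) fires′)
  ... | inj₁ d<m = clash V (sym e+[1+d]+[m∸[1+d]]≡e+m) (BlockOccurrence.one (occurrence V e fires))
                     (BlockOccurrence.zeros (occurrence V (e + suc d) fires′) (m ∸ suc d) (∸-monoʳ-< z<s d<m))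
    where
    -- the 1 of the first occurrence is one of the leading 0s of the second
    e+[1+d]+[m∸[1+d]]≡e+m : e + suc d + (m ∸ suc d) ≡ e + m
    e+[1+d]+[m∸[1+d]]≡e+m = trans (+-assoc e (suc d) (m ∸ suc d)) (cong (e +_) (m+[n∸m]≡n d<m))

evenBlock-exclusive : ∀ m → 2 ≤ m → Exclusive (blockPattern m true false) (suc m)
evenBlock-exclusive m 2≤m = block-exclusive true false λ V e occ occ′ →
  clash V (sym (trans (+-assoc e (suc m) 1) (cong (e +_) (+-comm (suc m) 1))))
    (BlockOccurrence.right₁ occ) (BlockOccurrence.zeros occ′ 1 2≤m)

oddBlock-exclusive : ∀ m → m ≡ 1 ⊎ 3 ≤ m → Exclusive (blockPattern m false true) (suc m)
oddBlock-exclusive .1 (inj₁ refl) = block-exclusive false true λ V e occ occ′ →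
  clash V (+-assoc e 2 1) (BlockOccurrence.one occ′) (BlockOccurrence.right₁ occ)
oddBlock-exclusive m (inj₂ 3≤m) = block-exclusive false true λ V e occ occ′ →
  clash V (sym (trans (+-assoc e (suc m) 2) (cong (e +_) (+-comm (suc m) 2))))
    (BlockOccurrence.right₂ occ) (BlockOccurrence.zeros occ′ 2 3≤m)

fEven-represents : ∀ m → Represents (fEven m) (rule (suc m) (blockPattern m true false))
fEven-represents m = represents-≗ (fEven≡blockRule m) (blockRule-represents m true false)

fOdd-represents : ∀ m → Represents (fOdd m) (rule (suc m) (blockPattern m false true))
fOdd-represents m = represents-≗ (fOdd≡blockRule m) (blockRule-represents m false true)

f5≗fOdd1 : ∀ x → f5 x ≡ fOdd 1 x
f5≗fOdd1 = from-yes (∀-Vec? 5 λ x → f5 x Bool.≟ fOdd 1 x)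

f6≗fEven2 : ∀ x → f6 x ≡ fEven 2 x
f6≗fEven2 = from-yes (∀-Vec? 6 λ x → f6 x Bool.≟ fEven 2 x)

f7≗fOdd3 : ∀ x → f7 x ≡ fOdd 3 x
f7≗fOdd3 = from-yes (∀-Vec? 7 λ x → f7 x Bool.≟ fOdd 3 x)

1+2j≡1⊎3≤1+2j : ∀ j → 1 + 2 * j ≡ 1 ⊎ 3 ≤ 1 + 2 * j
1+2j≡1⊎3≤1+2j zero = inj₁ refl
1+2j≡1⊎3≤1+2j (suc j) = inj₂ (s≤s (s≤s (≤-trans (s≤s z≤n) (m≤n+m (1 * suc j) j))))

mainTheorem7 : ((n : ℕ) → 4 ≤ n → IsLifting n f4)
    × ((n : ℕ) → 5 ≤ n → IsLifting n f5)
    × ((n : ℕ) → 6 ≤ n → IsLifting n f6)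
    × ((n : ℕ) → 7 ≤ n → IsLifting n f7)
    × ((j n : ℕ) → 6 + 2 * j ≤ n → IsLifting n (fEven (2 + 2 * j)))
    × ((j n : ℕ) → 5 + 2 * j ≤ n → IsLifting n (fOdd (1 + 2 * j)))
mainTheorem7 =
    (λ n _ → rule-lifting f4-local f4-exclusive f4-represents n)
  , (λ n _ → rule-lifting (block-local false true ≤-refl) (oddBlock-exclusive 1 (inj₁ refl))
                (represents-≗ f5≗fOdd1 (fOdd-represents 1)) n)
  , (λ n _ → rule-lifting (block-local true false (s≤s z≤n)) (evenBlock-exclusive 2 ≤-refl)
                (represents-≗ f6≗fEven2 (fEven-represents 2)) n)
  , (λ n _ → rule-lifting (block-local false true (s≤s z≤n)) (oddBlock-exclusive 3 (inj₂ ≤-refl))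
                (represents-≗ f7≗fOdd3 (fOdd-represents 3)) n)
  , (λ j n _ → rule-lifting (block-local true false (s≤s z≤n)) (evenBlock-exclusive (2 + 2 * j) (s≤s (s≤s z≤n)))
                  (fEven-represents (2 + 2 * j)) n)
  , (λ j n _ → rule-lifting (block-local false true (s≤s z≤n)) (oddBlock-exclusive (1 + 2 * j) (1+2j≡1⊎3≤1+2j j))
                  (fOdd-represents (1 + 2 * j)) n)
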